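{- Let $k\ge 2$, let $H_0$ be a finite $k$-uniform hypergraph with at least one hyperedge, and $H_t=\mathrm{ILTH}_t(H_0)$. Then the number of paths of length two in $H_t$ is $\Theta\left((k^2+1)^t\right)$ as $t\to\infty$.
   Context: ILTH model: given $H_t$, $H_{t+1}$ has vertex set $V(H_t)\cup\{x':x\in V(H_t)\}$ where each $x'$ is a new vertex (the clone of $x$), and hyperedge set $E(H_t)\cup\{(e\setminus\{x\})\cup\{x'\}: e\in E(H_t), x\in e\}$. A path of length two in a hypergraph is a 5-tuple $(u,e_1,v,e_2,w)$ with $u,v,w$ distinct vertices, $e_1,e_2$ distinct hyperedges, $u,v\in e_1$ and $v,w\in e_2$. Implied constants may depend on $k$ and $H_0$. -}

module Defs where

open import Data.Nat using (ℕ; zero; suc; _+_)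
open import Data.Fin using (Fin)
open import Data.Fin.Subset using (Subset; _∈_; _-_; ⁅_⁆; ∣_∣)
open import Data.Fin.Subset.Properties using (_∈?_)
import Data.Fin.Subset as S
open import Data.Fin.Properties using () renaming (_≟_ to _≟F_)
open import Data.List using (List; []; _∷_; map; concatMap; filter; allFin; length; lookup)
open import Data.List.Relation.Unary.All using (All)
open import Data.List.Relation.Unary.Unique.Propositional using (Unique)
open import Data.Vec using (_++_)
open import Data.Product using (_×_; _,_; Σ)
open import Relation.Binary.PropositionalEquality using (_≡_; _≢_)
open import Relation.Nullary using (Dec; ¬_)
open import Relation.Nullary.Decidable using (_×-dec_; ¬?)

record Hypergraph : Set where
  constructor hypergraph
  field
    n      : ℕ
    edges  : List (Subset n)
    unique : Unique edges
open Hypergraph public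

Uniform : ℕ → Hypergraph → Set
Uniform k H = All (λ e → ∣ e ∣ ≡ k) (edges H)

-- Vertices of the new hypergraph: Fin (n + n); the first n are
-- the old vertices, vertex (n + x) is the clone x' of x.
-- Old edge e ↦ e (with no clone vertices);
-- for e and x ∈ e, the new edge (e \ {x}) ∪ {x'}.
oldEdge : {n : ℕ} → Subset n → Subset (n + n)
oldEdge e = e ++ S.⊥

cloneEdge : {n : ℕ} → Subset n → Fin n → Subset (n + n)
cloneEdge e x = (e - x) ++ ⁅ x ⁆

cloneEdges : {n : ℕ} → List (Subset n) → List (Subset (n + n))
cloneEdges {n} es =
  concatMap (λ e → map (cloneEdge e) (filter (_∈? e) (allFin n))) es

stepEdges : {n : ℕ} → List (Subset n) → List (Subset (n + n))
stepEdges es = map oldEdge es Data.List.++ cloneEdges es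

-- The generated edge
-- lists are automatically duplicate-free (clone edges are pairwise distinct
-- and distinct from old edges), so edge positions identify hyperedges.
ILTHn : ℕ → ℕ → ℕ
ILTHn n zero = n
ILTHn n (suc t) = ILTHn n t + ILTHn n t

ILTHedges : {n : ℕ} → List (Subset n) → (t : ℕ) → List (Subset (ILTHn n t))
ILTHedges es zero = es
ILTHedges es (suc t) = stepEdges (ILTHedges es t)

-- Hyperedges are referred to by their position in the (duplicate-free)
-- edge list, so distinct positions = distinct hyperedges.
module _ {n : ℕ} (es : List (Subset n)) where
  private
    E = Fin (length es)
    edge : E → Subset n
    edge = lookup es

  Tuple : Set
  Tuple = Fin n × E × Fin n × E × Fin n

  IsPath2 : Tuple → Set
  IsPath2 (u , i , v , j , w) =
    (u ≢ v) × (v ≢ w) × (u ≢ w) × (i ≢ j) ×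
    (u ∈ edge i) × (v ∈ edge i) × (v ∈ edge j) × (w ∈ edge j)

  isPath2? : (p : Tuple) → Dec (IsPath2 p)
  isPath2? (u , i , v , j , w) =
    ¬? (u ≟F v) ×-dec ¬? (v ≟F w) ×-dec ¬? (u ≟F w) ×-dec ¬? (i ≟F j) ×-dec
    (u ∈? edge i) ×-dec (v ∈? edge i) ×-dec (v ∈? edge j) ×-dec (w ∈? edge j)

  allTuples : List Tuple
  allTuples =
    concatMap (λ u → concatMap (λ i → concatMap (λ v → concatMap (λ j →
      map (λ w → (u , i , v , j , w)) (allFin n))
      (allFin (length es))) (allFin n)) (allFin (length es))) (allFin n)

  paths2 : ℕ
  paths2 = length (filter isPath2? allTuples)

pathsILTH : Hypergraph → ℕ → ℕ
pathsILTH H t = paths2 (ILTHedges (edges H) t)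

-- The proof tracks vertex degrees. Cloning multiplies the degree of an old
-- vertex by k (each of its edges yields k − 1 clone edges through it) and
-- gives the clone x' the degree of x. Hence Σ_v d(v)² grows exactly by the
-- factor k² + 1 per step, while Σ_v d(v)(d(v) − 1) grows at least by that
-- factor and is positive from H₁ on. The number of paths of length two is
-- at most k² Σ_v d(v)², since a path is determined by its middle vertex,
-- its two edges and one further vertex in each edge; it is at least
-- Σ_v d(v)(d(v) − 1), since in a hypergraph with distinct edges of size ≥ 2
-- any two distinct edges through v extend to a path through v.
module Submission where

open import Defs hiding (n)
open import Data.Bool using (Bool; true; false)
open import Data.Fin using (Fin; zero; suc; _↑ˡ_; _↑ʳ_)
open import Data.Fin.Properties using () renaming (_≟_ to _≟ᶠ_)
open import Data.Fin.Subset using (Subset; inside; outside; _∈_; _∉_; _-_; ⁅_⁆; ∣_∣; _⊆_; Nonempty)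
import Data.Fin.Subset as Subset
open import Data.Fin.Subset.Properties
  using (_∈?_; ∉⊥; ∣⊥∣≡0; ∣⁅x⁆∣≡1; p─⊥≡p; x∈⁅x⁆; x∈⁅y⁆⇒x≡y; x∈p∧x≢y⇒x∈p-y; p─q⊆p; ⊆-antisym; drop-there)
open import Data.List using (List; []; _∷_; _++_; map; filter; concatMap; allFin; tabulate; length; lookup)
open import Data.List.Properties using (map-++; map-∘; map-cong; map-cong-local)
open import Data.List.Membership.Propositional using () renaming (_∈_ to _∈ˡ_)
open import Data.List.Membership.Propositional.Properties using (∈-map⁻; ∈-++⁻; ∈-concat⁻′; ∈-filter⁻; ∈-lookup)
open import Data.List.Relation.Unary.All as All using (All; []; _∷_)
open import Data.List.Relation.Unary.Any using (here; there)
import Data.List.Relation.Unary.All.Properties as All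
import Data.List.Relation.Unary.AllPairs as AllPairs
open import Data.List.Relation.Unary.AllPairs using (_∷_)
import Data.List.Relation.Unary.AllPairs.Properties as AllPairs
open import Data.List.Relation.Unary.Unique.Propositional using (Unique)
import Data.List.Relation.Unary.Unique.Propositional.Properties as Unique
open import Data.List.Relation.Binary.Disjoint.Propositional using (Disjoint)
open import Data.Nat using (ℕ; zero; suc; _+_; _*_; _∸_; _^_; _≤_; _≥_; _<_; z≤n; s≤s)
open import Data.Nat.ListAction using () renaming (sum to sumˡ)
open import Data.Nat.ListAction.Properties using () renaming (sum-++ to sumˡ-++)
open import Data.Nat.Properties
open import Data.Nat.Tactic.RingSolver using (solve-∀)
open import Data.Product using (∃; ∃₂; _×_; _,_; proj₂)
import Data.Product as Product
open import Data.Sum using (_⊎_; inj₁; inj₂)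
import Data.Sum as Sum
open import Data.Vec using (_∷_; []; here; there) renaming (_++_ to _++ᵛ_)
import Data.Vec.Properties as Vec
open import Function using (_∘_; id)
open import Level using (Level)
open import Relation.Binary.PropositionalEquality
open import Relation.Nullary using (Dec; yes; no; does; contradiction)
open import Relation.Nullary.Decidable using (dec-true)
open import Relation.Unary using (Pred; Decidable)

open import Algebra.Properties.CommutativeSemigroup +-commutativeSemigroup using (interchange)
open import Algebra.Properties.Semiring.Sum +-*-semiring
  using (sum; sum-syntax; sum-cong-≗; ∑-distrib-+; ∑-comm; *-distribˡ-sum; *-distribʳ-sum; sum-replicate-zero)

private
  variable
    a p : Level
    A B : Set a
    k n : ℕ

𝟙 : Bool → ℕ
𝟙 true  = 1
𝟙 false = 0

𝟙-yes : {P : Set p} (P? : Dec P) → P → 𝟙 (does P?) ≡ 1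
𝟙-yes P? x = cong 𝟙 (dec-true P? x)

𝟙-≤ : {P : Set p} (P? : Dec P) {r : ℕ} → (P → 1 ≤ r) → 𝟙 (does P?) ≤ r
𝟙-≤ (yes x) 1≤r = 1≤r x
𝟙-≤ (no _)  _   = z≤n

𝟙-≤1 : ∀ b → 𝟙 b ≤ 1
𝟙-≤1 true  = s≤s z≤n
𝟙-≤1 false = z≤n

∑-mono-≤ : {f g : Fin n → ℕ} → (∀ i → f i ≤ g i) → sum f ≤ sum g
∑-mono-≤ {zero}  _   = z≤n
∑-mono-≤ {suc n} f≤g = +-mono-≤ (f≤g zero) (∑-mono-≤ (f≤g ∘ suc))

f≤∑f : (f : Fin n → ℕ) (i : Fin n) → f i ≤ sum f
f≤∑f f zero    = m≤m+n (f zero) _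
f≤∑f f (suc i) = ≤-trans (f≤∑f (f ∘ suc) i) (m≤n+m _ (f zero))

∑-split : ∀ m (f : Fin (m + n) → ℕ) → sum f ≡ sum (λ i → f (i ↑ˡ n)) + sum (λ j → f (m ↑ʳ j))
∑-split zero    f = refl
∑-split (suc m) f = trans (cong (f zero +_) (∑-split m (f ∘ suc))) (sym (+-assoc (f zero) _ _))

∑∑-* : ∀ {m n} (f : Fin m → ℕ) (g : Fin n → ℕ) → ∑[ i < m ] ∑[ j < n ] (f i * g j) ≡ sum f * sum g
∑∑-* f g = trans (sum-cong-≗ (λ i → sym (*-distribˡ-sum (f i) g))) (sym (*-distribʳ-sum (sum g) f))

∑∑-*ˡ : ∀ {m n} (c : ℕ) (f : Fin m → Fin n → ℕ) →
  ∑[ i < m ] ∑[ j < n ] (c * f i j) ≡ c * ∑[ i < m ] ∑[ j < n ] f i j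
∑∑-*ˡ {n = n} c f =
  trans (sum-cong-≗ (λ i → sym (*-distribˡ-sum c (f i)))) (sym (*-distribˡ-sum c (λ i → ∑[ j < n ] f i j)))

-- Defined through _∈?_ rather than Vec.lookup, so that filtering by _∈? p
-- (as in cloneEdges) is weighting by χ p.
χ : Subset n → Fin n → ℕ
χ p x = 𝟙 (does (x ∈? p))

χ≤1 : (p : Subset n) (x : Fin n) → χ p x ≤ 1
χ≤1 p x = 𝟙-≤1 (does (x ∈? p))

∈⇒χ≡1 : {p : Subset n} {x : Fin n} → x ∈ p → χ p x ≡ 1
∈⇒χ≡1 {p = p} {x} = 𝟙-yes (x ∈? p)

∉⇒χ≡0 : {p : Subset n} {x : Fin n} → x ∉ p → χ p x ≡ 0
∉⇒χ≡0 {p = p} {x} x∉p with x ∈? p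
... | yes x∈p = contradiction x∈p x∉p
... | no  _   = refl

χ*χ≤ : {p q : Subset n} {x y : Fin n} {r : ℕ} → (x ∈ p → y ∈ q → 1 ≤ r) → χ p x * χ q y ≤ r
χ*χ≤ {p = p} {q} {x} {y} both with x ∈? p | y ∈? q
... | yes x∈p | yes y∈q = both x∈p y∈q
... | yes _   | no  _   = z≤n
... | no  _   | _       = z≤n

∣p∣≡∑χ : (p : Subset n) → ∣ p ∣ ≡ sum (χ p)
∣p∣≡∑χ []            = refl
∣p∣≡∑χ (inside  ∷ p) = cong suc (∣p∣≡∑χ p)
∣p∣≡∑χ (outside ∷ p) = ∣p∣≡∑χ p

∑-χ⁅⁆ : (f : Fin n → ℕ) (x : Fin n) → ∑[ y < n ] (f y * χ ⁅ y ⁆ x) ≡ f x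
∑-χ⁅⁆ {suc n} f zero = begin
  f zero * 1 + ∑[ y < n ] (f (suc y) * 0) ≡⟨ cong₂ _+_ (*-identityʳ (f zero)) (sum-cong-≗ (*-zeroʳ ∘ f ∘ suc)) ⟩
  f zero + ∑[ y < n ] 0                 ≡⟨ cong (f zero +_) (sum-replicate-zero n) ⟩
  f zero + 0                            ≡⟨ +-identityʳ (f zero) ⟩
  f zero                                ∎
  where open ≡-Reasoning
∑-χ⁅⁆ {suc n} f (suc x) = begin
  f zero * χ Subset.⊥ x + rest ≡⟨ cong (λ c → f zero * c + rest) (∉⇒χ≡0 {x = x} ∉⊥) ⟩
  f zero * 0 + rest            ≡⟨ cong (_+ rest) (*-zeroʳ (f zero)) ⟩
  rest                         ≡⟨ ∑-χ⁅⁆ (f ∘ suc) x ⟩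
  f (suc x)                    ∎
  where
  open ≡-Reasoning
  rest : ℕ
  rest = ∑[ y < n ] (f (suc y) * χ ⁅ y ⁆ x)

χ-++ˡ : ∀ {m n} (p : Subset m) (q : Subset n) (x : Fin m) → χ (p ++ᵛ q) (x ↑ˡ n) ≡ χ p x
χ-++ˡ (inside  ∷ p) q zero    = refl
χ-++ˡ (outside ∷ p) q zero    = refl
χ-++ˡ (s ∷ p)       q (suc x) = χ-++ˡ p q x

χ-++ʳ : ∀ {m n} (p : Subset m) (q : Subset n) (x : Fin n) → χ (p ++ᵛ q) (m ↑ʳ x) ≡ χ q x
χ-++ʳ []      q x = refl
χ-++ʳ (s ∷ p) q x = χ-++ʳ p q x

-- The factor χ p y makes this hold also when y ∉ p.
χ-minus : (p : Subset n) (y x : Fin n) → χ p y * (χ (p - y) x + χ ⁅ y ⁆ x) ≡ χ p y * χ p x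
χ-minus (inside  ∷ p) zero    zero    = refl
χ-minus (outside ∷ p) zero    zero    = refl
χ-minus (s ∷ p)       zero    (suc x) = cong (χ (s ∷ p) zero *_) (begin
  χ (p Subset.─ Subset.⊥) x + χ Subset.⊥ x ≡⟨ cong₂ _+_ (cong (λ q → χ q x) (p─⊥≡p p)) (∉⇒χ≡0 {x = x} ∉⊥) ⟩
  χ p x + 0                                ≡⟨ +-identityʳ (χ p x) ⟩
  χ p x                                    ∎)
  where open ≡-Reasoning
χ-minus (inside  ∷ p) (suc y) zero    = refl
χ-minus (outside ∷ p) (suc y) zero    = refl
χ-minus (s ∷ p)       (suc y) (suc x) = χ-minus p y x

∣p++q∣≡∣p∣+∣q∣ : ∀ {m n} (p : Subset m) (q : Subset n) → ∣ p ++ᵛ q ∣ ≡ ∣ p ∣ + ∣ q ∣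
∣p++q∣≡∣p∣+∣q∣ []            q = refl
∣p++q∣≡∣p∣+∣q∣ (inside  ∷ p) q = cong suc (∣p++q∣≡∣p∣+∣q∣ p q)
∣p++q∣≡∣p∣+∣q∣ (outside ∷ p) q = ∣p++q∣≡∣p∣+∣q∣ p q

∣p-x∣+1≡∣p∣ : {p : Subset n} {x : Fin n} → x ∈ p → ∣ p - x ∣ + 1 ≡ ∣ p ∣
∣p-x∣+1≡∣p∣ {p = inside  ∷ p} here        = trans (cong (λ q → ∣ q ∣ + 1) (p─⊥≡p p)) (+-comm ∣ p ∣ 1)
∣p-x∣+1≡∣p∣ {p = inside  ∷ p} (there x∈p) = cong suc (∣p-x∣+1≡∣p∣ x∈p)
∣p-x∣+1≡∣p∣ {p = outside ∷ p} (there x∈p) = ∣p-x∣+1≡∣p∣ x∈p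

x∉p-x : (p : Subset n) (x : Fin n) → x ∉ p - x
x∉p-x (s ∷ p) zero    ()
x∉p-x (s ∷ p) (suc x) x∈p-x = x∉p-x p x (drop-there x∈p-x)

0<∣p∣⇒Nonempty : (p : Subset n) → 0 < ∣ p ∣ → Nonempty p
0<∣p∣⇒Nonempty (inside  ∷ p) _     = zero , here
0<∣p∣⇒Nonempty (outside ∷ p) 0<∣p∣ = Product.map suc there (0<∣p∣⇒Nonempty p 0<∣p∣)

∃-other : {p : Subset n} {x : Fin n} → 2 ≤ ∣ p ∣ → x ∈ p → ∃ λ w → w ∈ p × w ≢ x
∃-other {p = p} {x} 2≤∣p∣ x∈p =
  let w , w∈p-x = 0<∣p∣⇒Nonempty (p - x) (+-cancelʳ-≤ 1 1 _ (subst (2 ≤_) (sym (∣p-x∣+1≡∣p∣ x∈p)) 2≤∣p∣))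
  in w , p─q⊆p p ⁅ x ⁆ w∈p-x , λ w≡x → x∉p-x p x (subst (_∈ p - x) w≡x w∈p-x)

there∖ : ∀ {s t} {p q : Subset n} {x : Fin n} → x ∈ p × x ∉ q → suc x ∈ s ∷ p × suc x ∉ t ∷ q
there∖ (x∈p , x∉q) = there x∈p , x∉q ∘ drop-there

distinguish : (p q : Subset n) → p ≢ q → ∃ λ x → (x ∈ p × x ∉ q) ⊎ (x ∈ q × x ∉ p)
distinguish []            []            p≢q = contradiction refl p≢q
distinguish (inside  ∷ p) (outside ∷ q) _   = zero , inj₁ (here , λ ())
distinguish (outside ∷ p) (inside  ∷ q) _   = zero , inj₂ (here , λ ())
distinguish (inside  ∷ p) (inside  ∷ q) p≢q =
  Product.map suc (Sum.map there∖ there∖) (distinguish p q (p≢q ∘ cong (inside ∷_)))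
distinguish (outside ∷ p) (outside ∷ q) p≢q =
  Product.map suc (Sum.map there∖ there∖) (distinguish p q (p≢q ∘ cong (outside ∷_)))

sumˡ-map-++ : (f : A → ℕ) (xs ys : List A) → sumˡ (map f (xs ++ ys)) ≡ sumˡ (map f xs) + sumˡ (map f ys)
sumˡ-map-++ f xs ys = trans (cong sumˡ (map-++ f xs ys)) (sumˡ-++ (map f xs) (map f ys))

sumˡ-map-∘ : (f : B → ℕ) (g : A → B) (xs : List A) → sumˡ (map f (map g xs)) ≡ sumˡ (map (f ∘ g) xs)
sumˡ-map-∘ f g xs = cong sumˡ (sym (map-∘ xs))

sumˡ-map-concatMap : (f : B → ℕ) (g : A → List B) (xs : List A) →
  sumˡ (map f (concatMap g xs)) ≡ sumˡ (map (λ x → sumˡ (map f (g x))) xs)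
sumˡ-map-concatMap f g []       = refl
sumˡ-map-concatMap f g (x ∷ xs) =
  trans (sumˡ-map-++ f (g x) (concatMap g xs)) (cong (sumˡ (map f (g x)) +_) (sumˡ-map-concatMap f g xs))

sumˡ-map-filter : {P : Pred A p} (P? : Decidable P) (f : A → ℕ) (xs : List A) →
  sumˡ (map f (filter P? xs)) ≡ sumˡ (map (λ x → 𝟙 (does (P? x)) * f x) xs)
sumˡ-map-filter P? f [] = refl
sumˡ-map-filter P? f (x ∷ xs) with does (P? x)
... | true  = cong₂ _+_ (sym (+-identityʳ (f x))) (sumˡ-map-filter P? f xs)
... | false = sumˡ-map-filter P? f xs

length-filter≡sumˡ : {P : Pred A p} (P? : Decidable P) (xs : List A) →
  length (filter P? xs) ≡ sumˡ (map (λ x → 𝟙 (does (P? x))) xs)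
length-filter≡sumˡ P? [] = refl
length-filter≡sumˡ P? (x ∷ xs) with does (P? x)
... | true  = cong suc (length-filter≡sumˡ P? xs)
... | false = length-filter≡sumˡ P? xs

sumˡ-map-tabulate : (f : A → ℕ) (g : Fin n → A) → sumˡ (map f (tabulate g)) ≡ ∑[ i < n ] f (g i)
sumˡ-map-tabulate {n = zero}  f g = refl
sumˡ-map-tabulate {n = suc n} f g = cong (f (g zero) +_) (sumˡ-map-tabulate f (g ∘ suc))

sumˡ-map-allFin : (f : Fin n → ℕ) → sumˡ (map f (allFin n)) ≡ sum f
sumˡ-map-allFin f = sumˡ-map-tabulate f id

sumˡ-concatMap-allFin : (f : B → ℕ) (g : Fin n → List B) →
  sumˡ (map f (concatMap g (allFin n))) ≡ ∑[ x < n ] sumˡ (map f (g x))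
sumˡ-concatMap-allFin {n = n} f g =
  trans (sumˡ-map-concatMap f g (allFin n)) (sumˡ-map-allFin (λ x → sumˡ (map f (g x))))

∑-lookup : (f : A → ℕ) (xs : List A) → ∑[ i < length xs ] f (lookup xs i) ≡ sumˡ (map f xs)
∑-lookup f []       = refl
∑-lookup f (x ∷ xs) = cong (f x +_) (∑-lookup f xs)

sumˡ-map-+ : (f g : A → ℕ) (xs : List A) → sumˡ (map (λ x → f x + g x) xs) ≡ sumˡ (map f xs) + sumˡ (map g xs)
sumˡ-map-+ f g []       = refl
sumˡ-map-+ f g (x ∷ xs) =
  trans (cong (f x + g x +_) (sumˡ-map-+ f g xs)) (interchange (f x) (g x) (sumˡ (map f xs)) (sumˡ (map g xs)))

sumˡ-map-*ʳ : (f : A → ℕ) (c : ℕ) (xs : List A) → sumˡ (map (λ x → f x * c) xs) ≡ sumˡ (map f xs) * c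
sumˡ-map-*ʳ f c []       = refl
sumˡ-map-*ʳ f c (x ∷ xs) = trans (cong (f x * c +_) (sumˡ-map-*ʳ f c xs)) (sym (*-distribʳ-+ c (f x) _))

lookup-≢ : {xs : List A} → Unique xs → ∀ {i j} → i ≢ j → lookup xs i ≢ lookup xs j
lookup-≢ (_ ∷ _)       {zero}  {zero}  i≢j = contradiction refl i≢j
lookup-≢ (x∉xs ∷ _)    {zero}  {suc j} _   = All.lookup x∉xs (∈-lookup j)
lookup-≢ (x∉xs ∷ _)    {suc i} {zero}  _   = ≢-sym (All.lookup x∉xs (∈-lookup i))
lookup-≢ (_ ∷ unique)  {suc i} {suc j} i≢j = lookup-≢ unique (i≢j ∘ cong suc)

UniformEdges : ℕ → List (Subset n) → Set
UniformEdges k es = All (λ e → ∣ e ∣ ≡ k) es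

cloneEdgesOf : Subset n → List (Subset (n + n))
cloneEdgesOf {n} e = map (cloneEdge e) (filter (_∈? e) (allFin n))

∈-cloneEdgesOf⁻ : {e : Subset n} {e′ : Subset (n + n)} → e′ ∈ˡ cloneEdgesOf e → ∃ λ y → y ∈ e × e′ ≡ cloneEdge e y
∈-cloneEdgesOf⁻ {n} {e} e′∈ =
  let y , y∈filter , e′≡ = ∈-map⁻ (cloneEdge e) e′∈ in y , proj₂ (∈-filter⁻ (_∈? e) {xs = allFin n} y∈filter) , e′≡

∈-cloneEdges⁻ : (es : List (Subset n)) {e′ : Subset (n + n)} →
  e′ ∈ˡ cloneEdges es → ∃₂ λ e y → e ∈ˡ es × y ∈ e × e′ ≡ cloneEdge e y
∈-cloneEdges⁻ es e′∈ with ∈-concat⁻′ (map cloneEdgesOf es) e′∈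
... | _ , e′∈clones , clones∈ with ∈-map⁻ cloneEdgesOf clones∈
...   | e , e∈es , refl = let y , y∈e , e′≡ = ∈-cloneEdgesOf⁻ e′∈clones in e , y , e∈es , y∈e , e′≡

∣oldEdge∣ : (e : Subset n) → ∣ oldEdge e ∣ ≡ ∣ e ∣
∣oldEdge∣ {n} e = trans (∣p++q∣≡∣p∣+∣q∣ e Subset.⊥) (trans (cong (∣ e ∣ +_) (∣⊥∣≡0 n)) (+-identityʳ ∣ e ∣))

∣cloneEdge∣ : {e : Subset n} {y : Fin n} → y ∈ e → ∣ cloneEdge e y ∣ ≡ ∣ e ∣
∣cloneEdge∣ {e = e} {y} y∈e =
  trans (∣p++q∣≡∣p∣+∣q∣ (e - y) ⁅ y ⁆) (trans (cong (∣ e - y ∣ +_) (∣⁅x⁆∣≡1 y)) (∣p-x∣+1≡∣p∣ y∈e))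

stepEdges-uniform : {es : List (Subset n)} → UniformEdges k es → UniformEdges k (stepEdges es)
stepEdges-uniform {k = k} {es = es} uniform = All.tabulate size
  where
  size : ∀ {e′} → e′ ∈ˡ stepEdges es → ∣ e′ ∣ ≡ k
  size e′∈ with ∈-++⁻ (map oldEdge es) e′∈
  ... | inj₁ e′∈old   = let e , e∈es , e′≡ = ∈-map⁻ oldEdge e′∈old
                        in trans (cong ∣_∣ e′≡) (trans (∣oldEdge∣ e) (All.lookup uniform e∈es))
  ... | inj₂ e′∈clone = let e , y , e∈es , y∈e , e′≡ = ∈-cloneEdges⁻ es e′∈clone
                        in trans (cong ∣_∣ e′≡) (trans (∣cloneEdge∣ y∈e) (All.lookup uniform e∈es))

oldEdge-injective : {e e′ : Subset n} → oldEdge e ≡ oldEdge e′ → e ≡ e′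
oldEdge-injective {e = e} {e′} = Vec.++-injectiveˡ e e′

cloneEdge-injectiveʳ : {e e′ : Subset n} {y y′ : Fin n} → cloneEdge e y ≡ cloneEdge e′ y′ → y ≡ y′
cloneEdge-injectiveʳ {e = e} {e′} {y} {y′} eq =
  x∈⁅y⁆⇒x≡y y′ (subst (y ∈_) (Vec.++-injectiveʳ (e - y) (e′ - y′) eq) (x∈⁅x⁆ y))

p-y≡q-y⇒p⊆q : {p q : Subset n} {y : Fin n} → y ∈ q → p - y ≡ q - y → p ⊆ q
p-y≡q-y⇒p⊆q {p = p} {q} {y} y∈q eq {x} x∈p with x ≟ᶠ y
... | yes refl = y∈q
... | no  x≢y  = p─q⊆p q ⁅ y ⁆ (subst (x ∈_) eq (x∈p∧x≢y⇒x∈p-y x∈p x≢y))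

cloneEdge-injectiveˡ : {e e′ : Subset n} {y : Fin n} → y ∈ e → y ∈ e′ → cloneEdge e y ≡ cloneEdge e′ y → e ≡ e′
cloneEdge-injectiveˡ {e = e} {e′} {y} y∈e y∈e′ eq =
  ⊆-antisym (p-y≡q-y⇒p⊆q y∈e′ e-y≡e′-y) (p-y≡q-y⇒p⊆q y∈e (sym e-y≡e′-y))
  where
  e-y≡e′-y : e - y ≡ e′ - y
  e-y≡e′-y = Vec.++-injectiveˡ (e - y) (e′ - y) eq

oldEdge≢cloneEdge : (e e′ : Subset n) (y : Fin n) → oldEdge e ≢ cloneEdge e′ y
oldEdge≢cloneEdge e e′ y eq = ∉⊥ (subst (y ∈_) (sym (Vec.++-injectiveʳ e (e′ - y) eq)) (x∈⁅x⁆ y))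

stepEdges-unique : {es : List (Subset n)} → Unique es → Unique (stepEdges es)
stepEdges-unique {n} {es} unique =
  Unique.++⁺ (Unique.map⁺ oldEdge-injective unique)
             (Unique.concat⁺ (All.map⁺ (All.universal clones-unique es))
                             (AllPairs.map⁺ (AllPairs.map clones-disjoint unique)))
             old#clone
  where
  clones-unique : (e : Subset n) → Unique (cloneEdgesOf e)
  clones-unique e = Unique.map⁺ cloneEdge-injectiveʳ (Unique.filter⁺ (_∈? e) (Unique.allFin⁺ n))

  clones-disjoint : {e e′ : Subset n} → e ≢ e′ → Disjoint (cloneEdgesOf e) (cloneEdgesOf e′)
  clones-disjoint {e} {e′} e≢e′ (e″∈ , e″∈′) with ∈-cloneEdgesOf⁻ {e = e} e″∈ | ∈-cloneEdgesOf⁻ {e = e′} e″∈′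
  ... | y , y∈e , refl | y′ , y′∈e′ , eq with cloneEdge-injectiveʳ {e = e} {e′} {y} {y′} eq
  ...   | refl = e≢e′ (cloneEdge-injectiveˡ y∈e y′∈e′ eq)

  old#clone : Disjoint (map oldEdge es) (cloneEdges es)
  old#clone (e″∈old , e″∈clone) with ∈-map⁻ oldEdge e″∈old | ∈-cloneEdges⁻ es e″∈clone
  ... | e , _ , refl | e′ , y , _ , _ , eq = oldEdge≢cloneEdge e e′ y eq

deg : List (Subset n) → Fin n → ℕ
deg es v = sumˡ (map (λ e → χ e v) es)

deg-stepEdges : (es : List (Subset n)) (v : Fin (n + n)) →
  deg (stepEdges es) v ≡ sumˡ (map (λ e → χ (oldEdge e) v + ∑[ y < n ] (χ e y * χ (cloneEdge e y) v)) es)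
deg-stepEdges {n} es v = begin
  deg (stepEdges es) v
    ≡⟨ sumˡ-map-++ (χ′ v) (map oldEdge es) (cloneEdges es) ⟩
  sumˡ (map (χ′ v) (map oldEdge es)) + sumˡ (map (χ′ v) (concatMap cloneEdgesOf es))
    ≡⟨ cong₂ _+_ (sumˡ-map-∘ (χ′ v) oldEdge es) (sumˡ-map-concatMap (χ′ v) cloneEdgesOf es) ⟩
  sumˡ (map (χ′ v ∘ oldEdge) es) + sumˡ (map (λ e → sumˡ (map (χ′ v) (cloneEdgesOf e))) es)
    ≡⟨ cong (sumˡ (map (χ′ v ∘ oldEdge) es) +_) (cong sumˡ (map-cong clones es)) ⟩
  sumˡ (map (χ′ v ∘ oldEdge) es) + sumˡ (map (λ e → ∑[ y < n ] (χ e y * χ (cloneEdge e y) v)) es)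
    ≡⟨ sumˡ-map-+ (χ′ v ∘ oldEdge) _ es ⟨
  sumˡ (map (λ e → χ (oldEdge e) v + ∑[ y < n ] (χ e y * χ (cloneEdge e y) v)) es)
    ∎
  where
  open ≡-Reasoning
  χ′ : Fin (n + n) → Subset (n + n) → ℕ
  χ′ v e = χ e v
  clones : (e : Subset n) → sumˡ (map (χ′ v) (cloneEdgesOf e)) ≡ ∑[ y < n ] (χ e y * χ (cloneEdge e y) v)
  clones e = trans (sumˡ-map-∘ (χ′ v) (cloneEdge e) (filter (_∈? e) (allFin n)))
                   (trans (sumˡ-map-filter (_∈? e) (χ′ v ∘ cloneEdge e) (allFin n))
                          (sumˡ-map-allFin (λ y → χ e y * χ (cloneEdge e y) v)))

oldVertex-contribution : (e : Subset n) (x : Fin n) →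
  χ (oldEdge e) (x ↑ˡ n) + ∑[ y < n ] (χ e y * χ (cloneEdge e y) (x ↑ˡ n)) ≡ χ e x * ∣ e ∣
oldVertex-contribution {n} e x = begin
  χ (oldEdge e) (x ↑ˡ n) + ∑[ y < n ] (χ e y * χ (cloneEdge e y) (x ↑ˡ n))
    ≡⟨ cong₂ _+_ (χ-++ˡ e Subset.⊥ x) (sum-cong-≗ (λ y → cong (χ e y *_) (χ-++ˡ (e - y) ⁅ y ⁆ x))) ⟩
  χ e x + viaMinus
    ≡⟨ +-comm (χ e x) viaMinus ⟩
  viaMinus + χ e x
    ≡⟨ cong (viaMinus +_) (∑-χ⁅⁆ (χ e) x) ⟨
  viaMinus + ∑[ y < n ] (χ e y * χ ⁅ y ⁆ x)
    ≡⟨ ∑-distrib-+ (λ y → χ e y * χ (e - y) x) (λ y → χ e y * χ ⁅ y ⁆ x) ⟨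
  ∑[ y < n ] (χ e y * χ (e - y) x + χ e y * χ ⁅ y ⁆ x)
    ≡⟨ sum-cong-≗ (λ y → trans (sym (*-distribˡ-+ (χ e y) _ _)) (χ-minus e y x)) ⟩
  ∑[ y < n ] (χ e y * χ e x)
    ≡⟨ *-distribʳ-sum (χ e x) (χ e) ⟨
  sum (χ e) * χ e x
    ≡⟨ cong (_* χ e x) (∣p∣≡∑χ e) ⟨
  ∣ e ∣ * χ e x
    ≡⟨ *-comm ∣ e ∣ (χ e x) ⟩
  χ e x * ∣ e ∣
    ∎
  where
  open ≡-Reasoning
  viaMinus : ℕ
  viaMinus = ∑[ y < n ] (χ e y * χ (e - y) x)

cloneVertex-contribution : (e : Subset n) (x : Fin n) →
  χ (oldEdge e) (n ↑ʳ x) + ∑[ y < n ] (χ e y * χ (cloneEdge e y) (n ↑ʳ x)) ≡ χ e x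
cloneVertex-contribution {n} e x = begin
  χ (oldEdge e) (n ↑ʳ x) + ∑[ y < n ] (χ e y * χ (cloneEdge e y) (n ↑ʳ x))
    ≡⟨ cong₂ _+_ (trans (χ-++ʳ e Subset.⊥ x) (∉⇒χ≡0 {x = x} ∉⊥))
                 (sum-cong-≗ (λ y → cong (χ e y *_) (χ-++ʳ (e - y) ⁅ y ⁆ x))) ⟩
  ∑[ y < n ] (χ e y * χ ⁅ y ⁆ x)
    ≡⟨ ∑-χ⁅⁆ (χ e) x ⟩
  χ e x
    ∎
  where open ≡-Reasoning

deg-oldVertex : {es : List (Subset n)} → UniformEdges k es → (x : Fin n) → deg (stepEdges es) (x ↑ˡ n) ≡ deg es x * k
deg-oldVertex {n} {k} {es} uniform x = begin
  deg (stepEdges es) (x ↑ˡ n)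
    ≡⟨ deg-stepEdges es (x ↑ˡ n) ⟩
  sumˡ (map (λ e → χ (oldEdge e) (x ↑ˡ n) + ∑[ y < n ] (χ e y * χ (cloneEdge e y) (x ↑ˡ n))) es)
    ≡⟨ cong sumˡ (map-cong-local (All.map contribution uniform)) ⟩
  sumˡ (map (λ e → χ e x * k) es)
    ≡⟨ sumˡ-map-*ʳ (λ e → χ e x) k es ⟩
  deg es x * k
    ∎
  where
  open ≡-Reasoning
  contribution : {e : Subset n} → ∣ e ∣ ≡ k →
    χ (oldEdge e) (x ↑ˡ n) + ∑[ y < n ] (χ e y * χ (cloneEdge e y) (x ↑ˡ n)) ≡ χ e x * k
  contribution {e} ∣e∣≡k = trans (oldVertex-contribution e x) (cong (χ e x *_) ∣e∣≡k)

deg-cloneVertex : (es : List (Subset n)) (x : Fin n) → deg (stepEdges es) (n ↑ʳ x) ≡ deg es x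
deg-cloneVertex {n} es x =
  trans (deg-stepEdges es (n ↑ʳ x)) (cong sumˡ (map-cong (λ e → cloneVertex-contribution e x) es))

∑-stepEdges : {es : List (Subset n)} → UniformEdges k es → (g : ℕ → ℕ) →
  ∑[ v < n + n ] g (deg (stepEdges es) v) ≡ ∑[ x < n ] g (deg es x * k) + ∑[ x < n ] g (deg es x)
∑-stepEdges {n} {es = es} uniform g =
  trans (∑-split n (g ∘ deg (stepEdges es)))
        (cong₂ _+_ (sum-cong-≗ (cong g ∘ deg-oldVertex uniform)) (sum-cong-≗ (cong g ∘ deg-cloneVertex es)))

∑deg² : List (Subset n) → ℕ
∑deg² {n} es = ∑[ v < n ] (deg es v * deg es v)

∑deg[deg∸1] : List (Subset n) → ℕ
∑deg[deg∸1] {n} es = ∑[ v < n ] (deg es v * (deg es v ∸ 1))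

∑deg²-stepEdges : {es : List (Subset n)} → UniformEdges k es → ∑deg² (stepEdges es) ≡ (k * k + 1) * ∑deg² es
∑deg²-stepEdges {n} {k} {es} uniform = begin
  ∑deg² (stepEdges es)
    ≡⟨ ∑-stepEdges uniform (λ d → d * d) ⟩
  ∑[ x < n ] (deg es x * k * (deg es x * k)) + ∑deg² es
    ≡⟨ cong (_+ ∑deg² es) (sum-cong-≗ (λ x → square-scale (deg es x) k)) ⟩
  ∑[ x < n ] (k * k * (deg es x * deg es x)) + ∑deg² es
    ≡⟨ cong (_+ ∑deg² es) (*-distribˡ-sum (k * k) (λ x → deg es x * deg es x)) ⟨
  k * k * ∑deg² es + ∑deg² es
    ≡⟨ cong (k * k * ∑deg² es +_) (*-identityˡ (∑deg² es)) ⟨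
  k * k * ∑deg² es + 1 * ∑deg² es
    ≡⟨ *-distribʳ-+ (∑deg² es) (k * k) 1 ⟨
  (k * k + 1) * ∑deg² es
    ∎
  where
  open ≡-Reasoning
  square-scale : ∀ d k → d * k * (d * k) ≡ k * k * (d * d)
  square-scale = solve-∀

k*[d∸1]≤d*k∸1 : ∀ k d → k * (d ∸ 1) ≤ d * k ∸ 1
k*[d∸1]≤d*k∸1 zero    d = z≤n
k*[d∸1]≤d*k∸1 (suc k) d = begin
  suc k * (d ∸ 1)        ≡⟨ *-distribˡ-∸ (suc k) d 1 ⟩
  suc k * d ∸ suc k * 1  ≤⟨ ∸-monoʳ-≤ (suc k * d) (s≤s z≤n) ⟩
  suc k * d ∸ 1          ≡⟨ cong (_∸ 1) (*-comm (suc k) d) ⟩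
  d * suc k ∸ 1          ∎
  where open ≤-Reasoning

∑deg[deg∸1]-stepEdges : {es : List (Subset n)} → UniformEdges k es →
  (k * k + 1) * ∑deg[deg∸1] es ≤ ∑deg[deg∸1] (stepEdges es)
∑deg[deg∸1]-stepEdges {n} {k} {es} uniform = begin
  (k * k + 1) * ∑deg[deg∸1] es
    ≡⟨ *-distribʳ-+ (∑deg[deg∸1] es) (k * k) 1 ⟩
  k * k * ∑deg[deg∸1] es + 1 * ∑deg[deg∸1] es
    ≡⟨ cong₂ _+_ (*-distribˡ-sum (k * k) (λ x → deg es x * (deg es x ∸ 1))) (*-identityˡ (∑deg[deg∸1] es)) ⟩
  ∑[ x < n ] (k * k * (deg es x * (deg es x ∸ 1))) + ∑deg[deg∸1] es
    ≤⟨ +-monoˡ-≤ (∑deg[deg∸1] es) (∑-mono-≤ (λ x → pairs-scale (deg es x))) ⟩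
  ∑[ x < n ] (deg es x * k * (deg es x * k ∸ 1)) + ∑deg[deg∸1] es
    ≡⟨ ∑-stepEdges uniform (λ d → d * (d ∸ 1)) ⟨
  ∑deg[deg∸1] (stepEdges es)
    ∎
  where
  open ≤-Reasoning
  pairs-scale : ∀ d → k * k * (d * (d ∸ 1)) ≤ d * k * (d * k ∸ 1)
  pairs-scale d = begin
    k * k * (d * (d ∸ 1))   ≡⟨ regroup k d (d ∸ 1) ⟩
    d * k * (k * (d ∸ 1))   ≤⟨ *-monoʳ-≤ (d * k) (k*[d∸1]≤d*k∸1 k d) ⟩
    d * k * (d * k ∸ 1)     ∎
    where
    regroup : ∀ k d e → k * k * (d * e) ≡ d * k * (k * e)
    regroup = solve-∀

∈⇒1≤deg : {es : List (Subset n)} {e : Subset n} {x : Fin n} → e ∈ˡ es → x ∈ e → 1 ≤ deg es x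
∈⇒1≤deg {es = e ∷ es} {x = x} (here refl)  x∈e = ≤-trans (≤-reflexive (sym (∈⇒χ≡1 x∈e))) (m≤m+n _ (deg es x))
∈⇒1≤deg {es = e ∷ es} {x = x} (there e∈es) x∈e = ≤-trans (∈⇒1≤deg e∈es x∈e) (m≤n+m _ (χ e x))

k≤deg-oldVertex : {es : List (Subset n)} {e : Subset n} {x : Fin n} →
  UniformEdges k es → e ∈ˡ es → x ∈ e → k ≤ deg (stepEdges es) (x ↑ˡ n)
k≤deg-oldVertex {n} {k} {es} {x = x} uniform e∈es x∈e = begin
  k                            ≡⟨ *-identityˡ k ⟨
  1 * k                        ≤⟨ *-monoˡ-≤ k (∈⇒1≤deg e∈es x∈e) ⟩
  deg es x * k                 ≡⟨ deg-oldVertex uniform x ⟨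
  deg (stepEdges es) (x ↑ˡ n)  ∎
  where open ≤-Reasoning

1≤∑deg[deg∸1]-stepEdges : {es : List (Subset n)} → 2 ≤ k → UniformEdges k es → es ≢ [] →
  1 ≤ ∑deg[deg∸1] (stepEdges es)
1≤∑deg[deg∸1]-stepEdges {es = []} _ _ []≢[] = contradiction refl []≢[]
1≤∑deg[deg∸1]-stepEdges {n} {es = e ∷ es} 2≤k uniform@(∣e∣≡k ∷ _) _ =
  let x , x∈e = 0<∣p∣⇒Nonempty e (≤-trans (s≤s z≤n) (subst (2 ≤_) (sym ∣e∣≡k) 2≤k))
  in ≤-trans (pairs-positive (≤-trans 2≤k (k≤deg-oldVertex uniform (here refl) x∈e)))
             (f≤∑f (λ v → deg (stepEdges (e ∷ es)) v * (deg (stepEdges (e ∷ es)) v ∸ 1)) (x ↑ˡ n))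
  where
  pairs-positive : ∀ {d} → 2 ≤ d → 1 ≤ d * (d ∸ 1)
  pairs-positive {suc zero}    (s≤s ())
  pairs-positive {suc (suc _)} _ = s≤s z≤n

module _ {n : ℕ} (es : List (Subset n)) where

  private
    E : ℕ
    E = length es

    edge : Fin E → Subset n
    edge = lookup es

  isPath : Fin n → Fin E → Fin n → Fin E → Fin n → ℕ
  isPath u i v j w = 𝟙 (does (isPath2? es (u , i , v , j , w)))

  pathsVia : Fin n → Fin E → Fin E → ℕ
  pathsVia v i j = ∑[ u < n ] ∑[ w < n ] isPath u i v j w

  paths2≡∑⁵isPath : paths2 es ≡ ∑[ u < n ] ∑[ i < E ] ∑[ v < n ] ∑[ j < E ] ∑[ w < n ] isPath u i v j w
  paths2≡∑⁵isPath =
    trans (length-filter≡sumˡ (isPath2? es) (allTuples es))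
    (trans (sumˡ-concatMap-allFin {n = n} indicator _) (sum-cong-≗ (λ u →
     trans (sumˡ-concatMap-allFin {n = E} indicator _) (sum-cong-≗ (λ i →
     trans (sumˡ-concatMap-allFin {n = n} indicator _) (sum-cong-≗ (λ v →
     trans (sumˡ-concatMap-allFin {n = E} indicator _) (sum-cong-≗ (λ j →
     trans (sumˡ-map-∘ indicator _ (allFin n)) (sumˡ-map-allFin (isPath u i v j)))))))))))
    where
    indicator : Tuple es → ℕ
    indicator t = 𝟙 (does (isPath2? es t))

  paths2≡∑pathsVia : paths2 es ≡ ∑[ v < n ] ∑[ i < E ] ∑[ j < E ] pathsVia v i j
  paths2≡∑pathsVia = begin
    paths2 es
      ≡⟨ paths2≡∑⁵isPath ⟩
    ∑[ u < n ] ∑[ i < E ] ∑[ v < n ] ∑[ j < E ] ∑[ w < n ] isPath u i v j w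
      ≡⟨ sum-cong-≗ (λ u → ∑-comm (λ i v → ∑[ j < E ] ∑[ w < n ] isPath u i v j w)) ⟩
    ∑[ u < n ] ∑[ v < n ] ∑[ i < E ] ∑[ j < E ] ∑[ w < n ] isPath u i v j w
      ≡⟨ ∑-comm (λ u v → ∑[ i < E ] ∑[ j < E ] ∑[ w < n ] isPath u i v j w) ⟩
    ∑[ v < n ] ∑[ u < n ] ∑[ i < E ] ∑[ j < E ] ∑[ w < n ] isPath u i v j w
      ≡⟨ sum-cong-≗ (λ v → ∑-comm (λ u i → ∑[ j < E ] ∑[ w < n ] isPath u i v j w)) ⟩
    ∑[ v < n ] ∑[ i < E ] ∑[ u < n ] ∑[ j < E ] ∑[ w < n ] isPath u i v j w
      ≡⟨ sum-cong-≗ (λ v → sum-cong-≗ (λ i → ∑-comm (λ u j → ∑[ w < n ] isPath u i v j w))) ⟩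
    ∑[ v < n ] ∑[ i < E ] ∑[ j < E ] pathsVia v i j
      ∎
    where open ≡-Reasoning

  ∑∑χχ≡deg² : (v : Fin n) → ∑[ i < E ] ∑[ j < E ] (χ (edge i) v * χ (edge j) v) ≡ deg es v * deg es v
  ∑∑χχ≡deg² v = trans (∑∑-* (λ i → χ (edge i) v) (λ j → χ (edge j) v))
                      (cong₂ _*_ (∑-lookup (λ e → χ e v) es) (∑-lookup (λ e → χ e v) es))

  isPath≤ : ∀ u i v j w → isPath u i v j w ≤ χ (edge i) v * χ (edge j) v * (χ (edge i) u * χ (edge j) w)
  isPath≤ u i v j w = 𝟙-≤ (isPath2? es (u , i , v , j , w)) λ (_ , _ , _ , _ , u∈i , v∈i , v∈j , w∈j) →
    ≤-reflexive (sym (cong₂ _*_ (cong₂ _*_ (∈⇒χ≡1 v∈i) (∈⇒χ≡1 v∈j)) (cong₂ _*_ (∈⇒χ≡1 u∈i) (∈⇒χ≡1 w∈j))))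

  pathsVia≤ : UniformEdges k es → ∀ v i j → pathsVia v i j ≤ k * k * (χ (edge i) v * χ (edge j) v)
  pathsVia≤ {k} uniform v i j = begin
    pathsVia v i j
      ≤⟨ ∑-mono-≤ (λ u → ∑-mono-≤ (isPath≤ u i v j)) ⟩
    ∑[ u < n ] ∑[ w < n ] (c * (χ (edge i) u * χ (edge j) w))
      ≡⟨ ∑∑-*ˡ c (λ u w → χ (edge i) u * χ (edge j) w) ⟩
    c * ∑[ u < n ] ∑[ w < n ] (χ (edge i) u * χ (edge j) w)
      ≡⟨ cong (c *_) (trans (∑∑-* (χ (edge i)) (χ (edge j))) (cong₂ _*_ (size i) (size j))) ⟩
    c * (k * k)
      ≡⟨ *-comm c (k * k) ⟩
    k * k * c
      ∎
    where
    open ≤-Reasoning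
    c : ℕ
    c = χ (edge i) v * χ (edge j) v
    size : ∀ i → sum (χ (edge i)) ≡ k
    size i = trans (sym (∣p∣≡∑χ (edge i))) (All.lookup uniform (∈-lookup i))

  paths2≤ : UniformEdges k es → paths2 es ≤ k * k * ∑deg² es
  paths2≤ {k} uniform = begin
    paths2 es
      ≡⟨ paths2≡∑pathsVia ⟩
    ∑[ v < n ] ∑[ i < E ] ∑[ j < E ] pathsVia v i j
      ≤⟨ ∑-mono-≤ (λ v → ∑-mono-≤ (λ i → ∑-mono-≤ (pathsVia≤ uniform v i))) ⟩
    ∑[ v < n ] ∑[ i < E ] ∑[ j < E ] (k * k * (χ (edge i) v * χ (edge j) v))
      ≡⟨ sum-cong-≗ (λ v → trans (∑∑-*ˡ (k * k) (λ i j → χ (edge i) v * χ (edge j) v))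
                                 (cong (k * k *_) (∑∑χχ≡deg² v))) ⟩
    ∑[ v < n ] (k * k * (deg es v * deg es v))
      ≡⟨ *-distribˡ-sum (k * k) (λ v → deg es v * deg es v) ⟨
    k * k * ∑deg² es
      ∎
    where open ≤-Reasoning

  IsPath2⇒1≤pathsVia : ∀ {u i v j w} → IsPath2 es (u , i , v , j , w) → 1 ≤ pathsVia v i j
  IsPath2⇒1≤pathsVia {u} {i} {v} {j} {w} path = begin
    1                             ≡⟨ 𝟙-yes (isPath2? es (u , i , v , j , w)) path ⟨
    isPath u i v j w              ≤⟨ f≤∑f (isPath u i v j) w ⟩
    ∑[ w < n ] isPath u i v j w   ≤⟨ f≤∑f (λ u → ∑[ w < n ] isPath u i v j w) u ⟩
    pathsVia v i j                ∎
    where open ≤-Reasoning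

  IsPath2-reverse : ∀ {u i v j w} → IsPath2 es (u , i , v , j , w) → IsPath2 es (w , j , v , i , u)
  IsPath2-reverse (u≢v , v≢w , u≢w , i≢j , u∈i , v∈i , v∈j , w∈j) =
    ≢-sym v≢w , ≢-sym u≢v , ≢-sym u≢w , ≢-sym i≢j , w∈j , v∈j , v∈i , u∈i

  extend-to-path : ∀ {x i v j} → 2 ≤ ∣ edge j ∣ → i ≢ j → v ∈ edge i → v ∈ edge j → x ∈ edge i → x ∉ edge j →
    ∃ λ w → IsPath2 es (x , i , v , j , w)
  extend-to-path 2≤∣j∣ i≢j v∈i v∈j x∈i x∉j =
    let w , w∈j , w≢v = ∃-other 2≤∣j∣ v∈j
    in w , (λ { refl → x∉j v∈j }) , ≢-sym w≢v , (λ { refl → x∉j w∈j }) , i≢j , x∈i , v∈i , v∈j , w∈j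

  1≤pathsVia : All (λ e → 2 ≤ ∣ e ∣) es → Unique es →
    ∀ {v i j} → i ≢ j → v ∈ edge i → v ∈ edge j → 1 ≤ pathsVia v i j
  1≤pathsVia large unique {v} {i} {j} i≢j v∈i v∈j
    with distinguish (edge i) (edge j) (lookup-≢ unique i≢j)
  ... | x , inj₁ (x∈i , x∉j) =
    IsPath2⇒1≤pathsVia (proj₂ (extend-to-path (All.lookup large (∈-lookup j)) i≢j v∈i v∈j x∈i x∉j))
  ... | x , inj₂ (x∈j , x∉i) = IsPath2⇒1≤pathsVia (IsPath2-reverse
    (proj₂ (extend-to-path (All.lookup large (∈-lookup i)) (≢-sym i≢j) v∈j v∈i x∈j x∉i)))

  χχ≤pathsVia+δ : All (λ e → 2 ≤ ∣ e ∣) es → Unique es → ∀ v i j →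
    χ (edge i) v * χ (edge j) v ≤ pathsVia v i j + χ (edge j) v * χ ⁅ j ⁆ i
  χχ≤pathsVia+δ large unique v i j = on-diagonal? (i ≟ᶠ j)
    where
    open ≤-Reasoning
    on-diagonal? : Dec (i ≡ j) → χ (edge i) v * χ (edge j) v ≤ pathsVia v i j + χ (edge j) v * χ ⁅ j ⁆ i
    on-diagonal? (no i≢j)  = ≤-trans (χ*χ≤ (1≤pathsVia large unique i≢j)) (m≤m+n (pathsVia v i j) _)
    on-diagonal? (yes refl) = begin
      χ (edge i) v * χ (edge i) v                ≤⟨ *-monoʳ-≤ (χ (edge i) v) (χ≤1 (edge i) v) ⟩
      χ (edge i) v * 1                           ≡⟨ cong (χ (edge i) v *_) (∈⇒χ≡1 (x∈⁅x⁆ i)) ⟨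
      χ (edge i) v * χ ⁅ i ⁆ i                   ≤⟨ m≤n+m _ (pathsVia v i i) ⟩
      pathsVia v i i + χ (edge i) v * χ ⁅ i ⁆ i  ∎

  deg[deg∸1]≤∑pathsVia : All (λ e → 2 ≤ ∣ e ∣) es → Unique es → ∀ v →
    deg es v * (deg es v ∸ 1) ≤ ∑[ i < E ] ∑[ j < E ] pathsVia v i j
  deg[deg∸1]≤∑pathsVia large unique v = begin
    d * (d ∸ 1)    ≡⟨ *-distribˡ-∸ d d 1 ⟩
    d * d ∸ d * 1  ≡⟨ cong (d * d ∸_) (*-identityʳ d) ⟩
    d * d ∸ d      ≤⟨ m≤n+o⇒m∸n≤o (d * d) d (subst (d * d ≤_) (+-comm P d) d²≤P+d) ⟩
    P              ∎
    where
    open ≤-Reasoning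
    d P : ℕ
    d = deg es v
    P = ∑[ i < E ] ∑[ j < E ] pathsVia v i j
    d²≤P+d : d * d ≤ P + d
    d²≤P+d = begin
      d * d
        ≡⟨ ∑∑χχ≡deg² v ⟨
      ∑[ i < E ] ∑[ j < E ] (χ (edge i) v * χ (edge j) v)
        ≤⟨ ∑-mono-≤ (λ i → ∑-mono-≤ (χχ≤pathsVia+δ large unique v i)) ⟩
      ∑[ i < E ] ∑[ j < E ] (pathsVia v i j + χ (edge j) v * χ ⁅ j ⁆ i)
        ≡⟨ sum-cong-≗ (λ i → ∑-distrib-+ (pathsVia v i) (λ j → χ (edge j) v * χ ⁅ j ⁆ i)) ⟩
      ∑[ i < E ] (∑[ j < E ] pathsVia v i j + ∑[ j < E ] (χ (edge j) v * χ ⁅ j ⁆ i))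
        ≡⟨ ∑-distrib-+ (λ i → ∑[ j < E ] pathsVia v i j) (λ i → ∑[ j < E ] (χ (edge j) v * χ ⁅ j ⁆ i)) ⟩
      P + ∑[ i < E ] ∑[ j < E ] (χ (edge j) v * χ ⁅ j ⁆ i)
        ≡⟨ cong (P +_) (trans (sum-cong-≗ (∑-χ⁅⁆ (λ j → χ (edge j) v))) (∑-lookup (λ e → χ e v) es)) ⟩
      P + d
        ∎

  ∑deg[deg∸1]≤paths2 : All (λ e → 2 ≤ ∣ e ∣) es → Unique es → ∑deg[deg∸1] es ≤ paths2 es
  ∑deg[deg∸1]≤paths2 large unique =
    ≤-trans (∑-mono-≤ (deg[deg∸1]≤∑pathsVia large unique)) (≤-reflexive (sym paths2≡∑pathsVia))

ILTH-uniform : {es : List (Subset n)} → UniformEdges k es → ∀ t → UniformEdges k (ILTHedges es t)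
ILTH-uniform uniform zero    = uniform
ILTH-uniform uniform (suc t) = stepEdges-uniform (ILTH-uniform uniform t)

ILTH-unique : {es : List (Subset n)} → Unique es → ∀ t → Unique (ILTHedges es t)
ILTH-unique unique zero    = unique
ILTH-unique unique (suc t) = stepEdges-unique (ILTH-unique unique t)

∑deg²-ILTH : {es : List (Subset n)} → UniformEdges k es → ∀ t → ∑deg² (ILTHedges es t) ≡ (k * k + 1) ^ t * ∑deg² es
∑deg²-ILTH {es = es} uniform zero = sym (*-identityˡ (∑deg² es))
∑deg²-ILTH {k = k} {es} uniform (suc t) = begin
  ∑deg² (ILTHedges es (suc t))                ≡⟨ ∑deg²-stepEdges (ILTH-uniform uniform t) ⟩
  (k * k + 1) * ∑deg² (ILTHedges es t)        ≡⟨ cong ((k * k + 1) *_) (∑deg²-ILTH uniform t) ⟩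
  (k * k + 1) * ((k * k + 1) ^ t * ∑deg² es)  ≡⟨ *-assoc (k * k + 1) _ (∑deg² es) ⟨
  (k * k + 1) ^ suc t * ∑deg² es              ∎
  where open ≡-Reasoning

∑deg[deg∸1]-ILTH : {es : List (Subset n)} → 2 ≤ k → UniformEdges k es → es ≢ [] →
  ∀ t → (k * k + 1) ^ t ≤ ∑deg[deg∸1] (ILTHedges es (suc t))
∑deg[deg∸1]-ILTH 2≤k uniform es≢[] zero    = 1≤∑deg[deg∸1]-stepEdges 2≤k uniform es≢[]
∑deg[deg∸1]-ILTH {k = k} 2≤k uniform es≢[] (suc t) =
  ≤-trans (*-monoʳ-≤ (k * k + 1) (∑deg[deg∸1]-ILTH 2≤k uniform es≢[] t))
          (∑deg[deg∸1]-stepEdges (ILTH-uniform uniform (suc t)))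

paths2-ILTH-upper : {es : List (Subset n)} → UniformEdges k es →
  ∀ t → paths2 (ILTHedges es t) ≤ k * k * ∑deg² es * (k * k + 1) ^ t
paths2-ILTH-upper {k = k} {es} uniform t = begin
  paths2 (ILTHedges es t)                       ≤⟨ paths2≤ (ILTHedges es t) (ILTH-uniform uniform t) ⟩
  k * k * ∑deg² (ILTHedges es t)                ≡⟨ cong (k * k *_) (∑deg²-ILTH uniform t) ⟩
  k * k * ((k * k + 1) ^ t * ∑deg² es)          ≡⟨ regroup (k * k) ((k * k + 1) ^ t) (∑deg² es) ⟩
  k * k * ∑deg² es * (k * k + 1) ^ t            ∎
  where
  open ≤-Reasoning
  regroup : ∀ c b q → c * (b * q) ≡ c * q * b
  regroup = solve-∀

paths2-ILTH-lower : {es : List (Subset n)} → 2 ≤ k → UniformEdges k es → Unique es → es ≢ [] →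
  ∀ t → (k * k + 1) ^ suc t ≤ (k * k + 1) * paths2 (ILTHedges es (suc t))
paths2-ILTH-lower {k = k} {es} 2≤k uniform unique es≢[] t =
  *-monoʳ-≤ (k * k + 1) (≤-trans (∑deg[deg∸1]-ILTH 2≤k uniform es≢[] t)
                                 (∑deg[deg∸1]≤paths2 (ILTHedges es (suc t)) large (ILTH-unique unique (suc t))))
  where
  large : All (λ e → 2 ≤ ∣ e ∣) (ILTHedges es (suc t))
  large = All.map (λ ∣e∣≡k → subst (2 ≤_) (sym ∣e∣≡k) 2≤k) (ILTH-uniform uniform (suc t))

lemma12 : (k : ℕ) → k ≥ 2 → (H : Hypergraph) → Uniform k H → edges H ≢ [] →
    ∃ λ a → ∃ λ b → ∃ λ T → (t : ℕ) → t ≥ T →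
      ((k * k + 1) ^ t ≤ a * pathsILTH H t) × (pathsILTH H t ≤ b * (k * k + 1) ^ t)
lemma12 k 2≤k H uniform edges≢[] = k * k + 1 , k * k * ∑deg² (edges H) , 1 , bounds
  where
  bounds : (t : ℕ) → t ≥ 1 →
    ((k * k + 1) ^ t ≤ (k * k + 1) * pathsILTH H t) × (pathsILTH H t ≤ k * k * ∑deg² (edges H) * (k * k + 1) ^ t)
  bounds zero    ()
  bounds (suc t) _  = paths2-ILTH-lower 2≤k uniform (unique H) edges≢[] t , paths2-ILTH-upper uniform (suc t)
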